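{- Let $G$ be a graph with no isolated vertices such that $\mathcal{TS}_+(G)\cong K_n$. Then $G\cong K_n$.
   Context: PSD forcing on a graph $G$: vertices are blue or white; starting from an initial blue set $B$, repeatedly apply: if $C$ is a connected component of the graph obtained from $G$ by deleting the currently blue vertices, and $u$ is a blue vertex with $N_G(u)\cap V(C)=\{w\}$, then $w$ becomes blue. $B$ is a PSD forcing set if eventually all vertices are blue; $\mathrm{Z}_+(G)$ is the minimum size of a PSD forcing set. $\mathcal{TS}_+(G)$ has as vertices the PSD forcing sets of size $\mathrm{Z}_+(G)$, with $S_1S_2$ an edge iff there are $v_1\in S_1\setminus S_2$, $v_2\in S_2\setminus S_1$ with $S_1\setminus\{v_1\}=S_2\setminus\{v_2\}$ and $v_1v_2\in E(G)$. -}

module Defs where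

open import Data.Nat using (ℕ; suc; _≤_)
open import Data.Fin using (Fin)
open import Data.Fin.Subset using (Subset; _∈_; _∉_; ⁅_⁆; _∪_; _-_; ∣_∣; ⊤)
open import Data.Bool using (Bool; true; false)
open import Data.Product using (Σ; ∃; _×_; _,_)
open import Relation.Binary.PropositionalEquality using (_≡_; _≢_)
open import Relation.Binary.Construct.Closure.ReflexiveTransitive using (Star)
open import Function.Bundles using (_⇔_; _↔_; Inverse)

record Graph (m : ℕ) : Set where
  field
    adj   : Fin m → Fin m → Bool
    sym   : ∀ u v → adj u v ≡ adj v u
    irrefl : ∀ v → adj v v ≡ false
open Graph public

Adj : ∀ {m} → Graph m → Fin m → Fin m → Set
Adj G u v = adj G u v ≡ true

NoIsolated : ∀ {m} → Graph m → Set
NoIsolated {m} G = ∀ v → ∃ λ u → Adj G v u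

-- WhitePath G B x y : y lies in the connected component of G - B containing x
-- (x, y and all vertices on the path are white, i.e. not in B).
data WhitePath {m} (G : Graph m) (B : Subset m) : Fin m → Fin m → Set where
  here : ∀ {x} → x ∉ B → WhitePath G B x x
  step : ∀ {x z y} → x ∉ B → Adj G x z → WhitePath G B z y → WhitePath G B x y

-- u forces w with respect to blue set B (PSD color change rule): u is blue,
-- w is white, and w is the unique neighbour of u in the component C of G - B
-- containing w.
PSDForce : ∀ {m} → Graph m → Subset m → Fin m → Fin m → Set
PSDForce G B u w =
  u ∈ B × w ∉ B × Adj G u w ×
  (∀ x → WhitePath G B w x → Adj G u x → x ≡ w)

data PSDStep {m} (G : Graph m) : Subset m → Subset m → Set where
  force : ∀ {B} u w → PSDForce G B u w → PSDStep G B (⁅ w ⁆ ∪ B)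

IsPSDForcingSet : ∀ {m} → Graph m → Subset m → Set
IsPSDForcingSet G B = Star (PSDStep G) B ⊤

IsMinPSDForcingSet : ∀ {m} → Graph m → Subset m → Set
IsMinPSDForcingSet G B =
  IsPSDForcingSet G B × (∀ B' → IsPSDForcingSet G B' → ∣ B ∣ ≤ ∣ B' ∣)

TSAdj : ∀ {m} → Graph m → Subset m → Subset m → Set
TSAdj G S₁ S₂ = Σ _ λ v₁ → Σ _ λ v₂ →
  v₁ ∈ S₁ × v₁ ∉ S₂ × v₂ ∈ S₂ × v₂ ∉ S₁ × (S₁ - v₁ ≡ S₂ - v₂) × Adj G v₁ v₂

TSIsoComplete : ∀ {m} → Graph m → ℕ → Set
TSIsoComplete {m} G n = Σ (Fin n → Subset m) λ f →
  (∀ i → IsMinPSDForcingSet G (f i)) ×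
  (∀ i j → f i ≡ f j → i ≡ j) ×
  (∀ S → IsMinPSDForcingSet G S → ∃ λ i → f i ≡ S) ×
  (∀ i j → TSAdj G (f i) (f j) ⇔ (i ≢ j))

IsoComplete : ∀ {m} → Graph m → ℕ → Set
IsoComplete {m} G n = Σ (Fin n ↔ Fin m) λ g →
  ∀ i j → Adj G (Inverse.to g i) (Inverse.to g j) ⇔ (i ≢ j)

-- In a minimum PSD forcing set S, suppose v forces z.  Sliding the token from
-- v to z gives another minimum PSD forcing set (z forces v back), so when
-- TS₊(G) is complete the slides along two different first forces must be
-- adjacent in TS₊(G); this forces every first force of S to hit the same
-- vertex, and then every component of G − S to be that single vertex.  Hence
-- each minimum PSD forcing set misses exactly one vertex, every V(G) − v is one
-- (no vertex is isolated), and a token slide between V(G) − u and V(G) − v is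
-- exactly an edge uv.  So u ↦ V(G) − u is an isomorphism G ≅ TS₊(G) ≅ Kₙ.
module Submission where

open import Defs
open import Data.Nat using (ℕ; suc; _≤_; _<_; _+_; z≤n; s≤s; _≤?_)
open import Data.Nat.Properties
  using (≤-trans; ≤-reflexive; ≤-antisym; ≤-pred; +-suc; +-monoʳ-≤; ≰⇒>; <⇒≤; <-irrefl)
  renaming (module ≤-Reasoning to ℕ-≤-Reasoning)
open import Data.Nat.Induction using (<-rec)
open import Data.Fin using (Fin; zero; suc; _≟_)
open import Data.Fin.Subset
  using (Subset; _∈_; _∉_; ⁅_⁆; _∪_; _-_; _─_; ∣_∣; ⊤; ∁; _⊆_; inside; outside)
open import Data.Fin.Subset.Properties
open import Data.Vec using ([]; _∷_; there)
open import Data.Product using (∃; ∃₂; _×_; _,_; proj₁; proj₂)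
open import Data.Sum using (_⊎_; inj₁; inj₂)
open import Data.Empty using (⊥-elim)
open import Function using (_∘_)
open import Relation.Nullary using (¬_; yes; no)
open import Relation.Nullary.Decidable using (decidable-stable)
open import Relation.Binary.PropositionalEquality
  using (_≡_; _≢_; refl; trans; cong; subst; subst₂) renaming (sym to ≡-sym)
open import Relation.Binary.Construct.Closure.ReflexiveTransitive using (Star; ε; _◅_)
open import Function.Bundles using (_⇔_; Equivalence; mk⇔; mk↔ₛ′)

private
  variable
    k : ℕ
    p q r : Subset k
    w x y z : Fin k

-- Minimality is not decidable, so this goes by strong induction on size: an
-- element below n would be minimal, since every smaller one is at least n.
lowerBound-fromMinimal : ∀ {A : Set} (P : A → Set) (size : A → ℕ) (n : ℕ) →
  (∀ a → P a → (∀ b → P b → size a ≤ size b) → n ≤ size a) →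
  ∀ a → P a → n ≤ size a
lowerBound-fromMinimal P size n minimal⇒n≤ a Pa = <-rec Q bound (size a) a refl Pa
  where
  Q : ℕ → Set
  Q s = ∀ a → size a ≡ s → P a → n ≤ size a
  bound : ∀ s → (∀ {t} → t < s → Q t) → Q s
  bound s rec a refl Pa with n ≤? size a
  ... | yes n≤ = n≤
  ... | no n≰ = ⊥-elim (n≰ (minimal⇒n≤ a Pa minimal))
    where
    minimal : ∀ b → P b → size a ≤ size b
    minimal b Pb with size a ≤? size b
    ... | yes a≤b = a≤b
    ... | no a≰b = ⊥-elim (n≰ (≤-trans (rec b<a b refl Pb) (<⇒≤ b<a)))
      where b<a = ≰⇒> a≰b

x∈p─q⇒x∉q : x ∈ p ─ q → x ∉ q
x∈p─q⇒x∉q {x = zero} {p = _ ∷ _} {q = inside ∷ _} () _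
x∈p─q⇒x∉q {x = zero} {p = _ ∷ _} {q = outside ∷ _} _ ()
x∈p─q⇒x∉q {x = suc _} {p = _ ∷ _} {q = _ ∷ _} (there x∈) (there x∈q) =
  x∈p─q⇒x∉q x∈ x∈q

x∈p-y⇒x≢y : x ∈ p - y → x ≢ y
x∈p-y⇒x≢y {y = y} x∈ refl = x∈p─q⇒x∉q x∈ (x∈⁅x⁆ y)

x∈p-y⇒x∈p : x ∈ p - y → x ∈ p
x∈p-y⇒x∈p {p = p} {y = y} = p─q⊆p p ⁅ y ⁆

z∈p∧z∉q⇒z≡x : p - x ≡ q - y → z ∈ p → z ∉ q → z ≡ x
z∈p∧z∉q⇒z≡x {x = x} {z = z} eq z∈p z∉q with z ≟ x
... | yes z≡x = z≡x
... | no z≢x = ⊥-elim (z∉q (x∈p-y⇒x∈p (subst (z ∈_) eq (x∈p∧x≢y⇒x∈p-y z∈p z≢x))))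

x∉⊤-y⇒x≡y : x ∉ ⊤ - y → x ≡ y
x∉⊤-y⇒x≡y {x = x} {y = y} x∉ with x ≟ y
... | yes x≡y = x≡y
... | no x≢y = ⊥-elim (x∉ (x∈p∧x≢y⇒x∈p-y ∈⊤ x≢y))

∪-monoʳ-⊆ : q ⊆ r → p ∪ q ⊆ p ∪ r
∪-monoʳ-⊆ {q = q} {p = p} q⊆r x∈ with x∈p∪q⁻ p q x∈
... | inj₁ x∈p = x∈p∪q⁺ (inj₁ x∈p)
... | inj₂ x∈q = x∈p∪q⁺ (inj₂ (q⊆r x∈q))

p⊆⁅x⁆∪p-x : p ⊆ ⁅ x ⁆ ∪ (p - x)
p⊆⁅x⁆∪p-x {x = x} {x = z} z∈p with z ≟ x
... | yes refl = x∈p∪q⁺ (inj₁ (x∈⁅x⁆ x))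
... | no z≢x = x∈p∪q⁺ (inj₂ (x∈p∧x≢y⇒x∈p-y z∈p z≢x))

∣p∪q∣≤∣p∣+∣q∣ : ∀ (p q : Subset k) → ∣ p ∪ q ∣ ≤ ∣ p ∣ + ∣ q ∣
∣p∪q∣≤∣p∣+∣q∣ [] [] = z≤n
∣p∪q∣≤∣p∣+∣q∣ (inside ∷ p) (b ∷ q) =
  s≤s (≤-trans (∣p∪q∣≤∣p∣+∣q∣ p q) (+-monoʳ-≤ ∣ p ∣ (∣p∣≤∣x∷p∣ b q)))
∣p∪q∣≤∣p∣+∣q∣ (outside ∷ p) (inside ∷ q) =
  ≤-trans (s≤s (∣p∪q∣≤∣p∣+∣q∣ p q)) (≤-reflexive (≡-sym (+-suc ∣ p ∣ ∣ q ∣)))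
∣p∪q∣≤∣p∣+∣q∣ (outside ∷ p) (outside ∷ q) = ∣p∪q∣≤∣p∣+∣q∣ p q

∣⁅x⁆∪p∣≤1+∣p∣ : ∀ (x : Fin k) p → ∣ ⁅ x ⁆ ∪ p ∣ ≤ suc ∣ p ∣
∣⁅x⁆∪p∣≤1+∣p∣ x p =
  ≤-trans (∣p∪q∣≤∣p∣+∣q∣ ⁅ x ⁆ p) (≤-reflexive (cong (_+ ∣ p ∣) (∣⁅x⁆∣≡1 x)))

∣⊤-x∣≡n : ∀ {n} (x : Fin (suc n)) → ∣ ⊤ - x ∣ ≡ n
∣⊤-x∣≡n {n} x = ≤-antisym (≤-pred upper) (≤-pred lower)
  where
  open ℕ-≤-Reasoning
  upper : suc ∣ ⊤ - x ∣ ≤ suc n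
  upper = begin-strict
    ∣ ⊤ - x ∣ <⟨ x∈p⇒∣p-x∣<∣p∣ {x = x} {p = ⊤} ∈⊤ ⟩
    ∣ ⊤ {suc n} ∣ ≡⟨ ∣⊤∣≡n (suc n) ⟩
    suc n ∎
  lower : suc n ≤ suc ∣ ⊤ - x ∣
  lower = begin
    suc n ≡⟨ ≡-sym (∣⊤∣≡n (suc n)) ⟩
    ∣ ⊤ {suc n} ∣ ≤⟨ p⊆q⇒∣p∣≤∣q∣ (p⊆⁅x⁆∪p-x {p = ⊤} {x = x}) ⟩
    ∣ ⁅ x ⁆ ∪ (⊤ - x) ∣ ≤⟨ ∣⁅x⁆∪p∣≤1+∣p∣ x (⊤ - x) ⟩
    suc ∣ ⊤ - x ∣ ∎

slide : Subset k → Fin k → Fin k → Subset k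
slide p x y = ⁅ y ⁆ ∪ (p - x)

y∈slide : ∀ (p : Subset k) x y → y ∈ slide p x y
y∈slide p x y = x∈p∪q⁺ (inj₁ (x∈⁅x⁆ y))

∈slide⁺ : z ∈ p → z ≢ x → z ∈ slide p x y
∈slide⁺ z∈p z≢x = x∈p∪q⁺ (inj₂ (x∈p∧x≢y⇒x∈p-y z∈p z≢x))

∈slide⁻ : z ∈ slide p x y → z ≡ y ⊎ (z ∈ p × z ≢ x)
∈slide⁻ {p = p} {x = x} {y = y} z∈ with x∈p∪q⁻ ⁅ y ⁆ (p - x) z∈
... | inj₁ z∈⁅y⁆ = inj₁ (x∈⁅y⁆⇒x≡y y z∈⁅y⁆)
... | inj₂ z∈p-x = inj₂ (x∈p-y⇒x∈p z∈p-x , x∈p-y⇒x≢y z∈p-x)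

∉slide : z ∉ p → z ≢ y → z ∉ slide p x y
∉slide z∉p z≢y z∈ with ∈slide⁻ z∈
... | inj₁ z≡y = z≢y z≡y
... | inj₂ (z∈p , _) = z∉p z∈p

x∉slide : x ∈ p → y ∉ p → x ∉ slide p x y
x∉slide x∈p y∉p x∈ with ∈slide⁻ x∈
... | inj₁ refl = y∉p x∈p
... | inj₂ (_ , x≢x) = x≢x refl

z∈p∧z∉slide⇒z≡x : z ∈ p → z ∉ slide p x y → z ≡ x
z∈p∧z∉slide⇒z≡x {z = z} {x = x} z∈p z∉ with z ≟ x
... | yes z≡x = z≡x
... | no z≢x = ⊥-elim (z∉ (∈slide⁺ z∈p z≢x))

p⊆⁅x⁆∪slide : p ⊆ ⁅ x ⁆ ∪ slide p x y
p⊆⁅x⁆∪slide {p = p} {x = x} {y = y} =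
  ⊆-trans p⊆⁅x⁆∪p-x (∪-monoʳ-⊆ (q⊆p∪q ⁅ y ⁆ (p - x)))

∣slide∣≤∣p∣ : x ∈ p → ∣ slide p x y ∣ ≤ ∣ p ∣
∣slide∣≤∣p∣ {x = x} {p = p} {y = y} x∈p =
  ≤-trans (∣⁅x⁆∪p∣≤1+∣p∣ y (p - x)) (x∈p⇒∣p-x∣<∣p∣ x∈p)

module WhitePaths {m} (G : Graph m) where

  Adj-sym : Adj G x y → Adj G y x
  Adj-sym {x = x} {y = y} e = trans (Graph.sym G y x) e

  Adj⇒≢ : Adj G x y → x ≢ y
  Adj⇒≢ {x = x} e refl with trans (≡-sym e) (irrefl G x)
  ... | ()

  WhitePath-start : WhitePath G p x y → x ∉ p
  WhitePath-start (here x∉) = x∉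
  WhitePath-start (step x∉ _ _) = x∉

  WhitePath-end : WhitePath G p x y → y ∉ p
  WhitePath-end (here y∉) = y∉
  WhitePath-end (step _ _ path) = WhitePath-end path

  WhitePath-snoc : WhitePath G p x y → Adj G y z → z ∉ p → WhitePath G p x z
  WhitePath-snoc (here x∉) e z∉ = step x∉ e (here z∉)
  WhitePath-snoc (step x∉ e path) e′ z∉ = step x∉ e (WhitePath-snoc path e′ z∉)

  WhitePath-reverse : WhitePath G p x y → WhitePath G p y x
  WhitePath-reverse (here x∉) = here x∉
  WhitePath-reverse (step x∉ e path) = WhitePath-snoc (WhitePath-reverse path) (Adj-sym e) x∉

  WhitePath-antimono : p ⊆ q → WhitePath G q x y → WhitePath G p x y
  WhitePath-antimono p⊆q (here x∉) = here (x∉ ∘ p⊆q)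
  WhitePath-antimono p⊆q (step x∉ e path) = step (x∉ ∘ p⊆q) e (WhitePath-antimono p⊆q path)

module Forcing {m} (G : Graph m) where

  open WhitePaths G

  IsPSDForcingSet-mono : p ⊆ q → IsPSDForcingSet G p → IsPSDForcingSet G q
  IsPSDForcingSet-mono p⊆q ε =
    subst (λ s → Star (PSDStep G) s ⊤) (≡-sym (⊆-antisym ⊆⊤ p⊆q)) ε
  IsPSDForcingSet-mono {p = p} {q = q} p⊆q (force u w (u∈ , _ , e , only) ◅ rest)
    with w ∈? q
  ... | yes w∈q = IsPSDForcingSet-mono ⁅w⁆∪p⊆q rest
    where
    ⁅w⁆∪p⊆q : ⁅ w ⁆ ∪ p ⊆ q
    ⁅w⁆∪p⊆q x∈ with x∈p∪q⁻ ⁅ w ⁆ p x∈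
    ... | inj₁ x∈⁅w⁆ = subst (_∈ q) (≡-sym (x∈⁅y⁆⇒x≡y w x∈⁅w⁆)) w∈q
    ... | inj₂ x∈p = p⊆q x∈p
  ... | no w∉q =
    force u w (p⊆q u∈ , w∉q , e , λ x path → only x (WhitePath-antimono p⊆q path))
      ◅ IsPSDForcingSet-mono (∪-monoʳ-⊆ p⊆q) rest

  ⊤-x-isPSDForcingSet : Adj G x y → IsPSDForcingSet G (⊤ - x)
  ⊤-x-isPSDForcingSet {x = x} {y = y} e =
    force y x (y∈ , x∉ , Adj-sym e , only) ◅ IsPSDForcingSet-mono p⊆⁅x⁆∪p-x ε
    where
    y∈ : y ∈ ⊤ - x
    y∈ = x∈p∧x≢y⇒x∈p-y ∈⊤ (Adj⇒≢ e ∘ ≡-sym)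
    x∉ : x ∉ ⊤ - x
    x∉ x∈ = x∈p-y⇒x≢y x∈ refl
    only : ∀ z → WhitePath G (⊤ - x) x z → Adj G y z → z ≡ x
    only z path _ = x∉⊤-y⇒x≡y (WhitePath-end path)

  -- After x forces y and the token slides from x to y, no white path leads
  -- from the old component of y back to x: x's only neighbour there was y.
  slide-separates : PSDForce G p x y → WhitePath G p y z →
                    WhitePath G (slide p x y) z w → w ≢ x
  slide-separates (x∈p , _ , _ , _) path (here _) refl = WhitePath-end path x∈p
  slide-separates {p = p} {x = x} {y = y} fxy@(_ , _ , _ , only) path
                  (step {z = z′} z∉ e rest) w≡x with z′ ≟ x
  ... | yes refl = z∉ (subst (_∈ slide p x y) (≡-sym (only _ path (Adj-sym e))) (y∈slide p x y))
  ... | no z′≢x = slide-separates fxy (WhitePath-snoc path e z′∉p) rest w≡x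
    where
    z′∉p : z′ ∉ p
    z′∉p z′∈p = WhitePath-start rest (∈slide⁺ z′∈p z′≢x)

  PSDForce-reverse : PSDForce G p x y → PSDForce G (slide p x y) y x
  PSDForce-reverse {p = p} {x = x} {y = y} fxy@(x∈p , y∉p , e , _) =
    y∈slide p x y , x∉slide x∈p y∉p , Adj-sym e , only
    where
    only : ∀ z → WhitePath G (slide p x y) x z → Adj G y z → z ≡ x
    only z path e′ with z ≟ x
    ... | yes z≡x = z≡x
    ... | no z≢x =
      ⊥-elim (slide-separates fxy (step y∉p e′ (here z∉p)) (WhitePath-reverse path) refl)
      where
      z∉p : z ∉ p
      z∉p z∈p = WhitePath-end path (∈slide⁺ z∈p z≢x)

  slide-isPSDForcingSet : IsPSDForcingSet G p → PSDForce G p x y → IsPSDForcingSet G (slide p x y)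
  slide-isPSDForcingSet forcing fxy =
    force _ _ (PSDForce-reverse fxy) ◅ IsPSDForcingSet-mono p⊆⁅x⁆∪slide forcing

  slide-isMin : IsMinPSDForcingSet G p → PSDForce G p x y → IsMinPSDForcingSet G (slide p x y)
  slide-isMin {y = y} (forcing , minimal) fxy@(x∈p , _) =
    slide-isPSDForcingSet forcing fxy ,
    λ q q-forcing → ≤-trans (∣slide∣≤∣p∣ {y = y} x∈p) (minimal q q-forcing)

  -- Follow the forcing chain from q ⊇ p while the component of x in G − p
  -- stays white; the first vertex of that component to turn blue is forced by
  -- a vertex that must already lie in p.  The ¬ ¬ avoids deciding WhitePath.
  componentForced-from : x ∉ p → p ⊆ q → (∀ z → WhitePath G p x z → z ∉ q) →
    Star (PSDStep G) q ⊤ → ¬ ¬ (∃₂ λ v z → PSDForce G p v z × WhitePath G p x z)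
  componentForced-from x∉p _ white ε stuck = white _ (here x∉p) ∈⊤
  componentForced-from {x = x} {p = p} {q = q} x∉p p⊆q white
                       (force u y (u∈q , _ , e , only) ◅ rest) stuck =
    componentForced-from x∉p (⊆-trans p⊆q (q⊆p∪q ⁅ y ⁆ q)) white′ rest stuck
    where
    lift : WhitePath G p x z → WhitePath G p z w → WhitePath G q z w
    lift to-z (here _) = here (white _ to-z)
    lift to-z (step _ e′ path) =
      step (white _ to-z) e′ (lift (WhitePath-snoc to-z e′ (WhitePath-start path)) path)
    u∈p : WhitePath G p x y → u ∈ p
    u∈p to-y with u ∈? p
    ... | yes u∈p = u∈p
    ... | no u∉p = ⊥-elim (white u (WhitePath-snoc to-y (Adj-sym e) u∉p) u∈q)
    y-unreachable : ¬ WhitePath G p x y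
    y-unreachable to-y =
      stuck (u , y , (u∈p to-y , WhitePath-end to-y , e , λ z → only z ∘ lift to-y) , to-y)
    white′ : ∀ z → WhitePath G p x z → z ∉ ⁅ y ⁆ ∪ q
    white′ z to-z z∈ with x∈p∪q⁻ ⁅ y ⁆ q z∈
    ... | inj₁ z∈⁅y⁆ = y-unreachable (subst (WhitePath G p x) (x∈⁅y⁆⇒x≡y y z∈⁅y⁆) to-z)
    ... | inj₂ z∈q = white z to-z z∈q

  componentForced : x ∉ p → IsPSDForcingSet G p →
    ¬ ¬ (∃₂ λ v z → PSDForce G p v z × WhitePath G p x z)
  componentForced x∉p = componentForced-from x∉p (λ z∈ → z∈) (λ _ path → WhitePath-end path)

  TSAdj⇒leaver-unique : TSAdj G p q → x ∈ p → x ∉ q → y ∈ p → y ∉ q → x ≡ y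
  TSAdj⇒leaver-unique (_ , _ , _ , _ , _ , _ , eq , _) x∈p x∉q y∈p y∉q =
    trans (z∈p∧z∉q⇒z≡x eq x∈p x∉q) (≡-sym (z∈p∧z∉q⇒z≡x eq y∈p y∉q))

  TSAdj⇒Adj : TSAdj G p q → x ∈ p → x ∉ q → y ∈ q → y ∉ p → Adj G x y
  TSAdj⇒Adj (_ , _ , _ , _ , _ , _ , eq , e) x∈p x∉q y∈q y∉p =
    subst₂ (Adj G) (≡-sym (z∈p∧z∉q⇒z≡x eq x∈p x∉q))
                   (≡-sym (z∈p∧z∉q⇒z≡x (≡-sym eq) y∈q y∉p)) e

TSComplete : ∀ {m} → Graph m → Set
TSComplete G = ∀ p q → IsMinPSDForcingSet G p → IsMinPSDForcingSet G q → p ≢ q → TSAdj G p q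

TSIsoComplete⇒TSComplete : ∀ {m} {G : Graph m} {n} → TSIsoComplete G n → TSComplete G
TSIsoComplete⇒TSComplete (f , _ , _ , f-onto , f-adj) p q p-isMin q-isMin p≢q
  with f-onto p p-isMin | f-onto q q-isMin
... | i , refl | j , refl = Equivalence.from (f-adj i j) (p≢q ∘ cong f)

module UniqueWhite {m} (G : Graph m) (complete : TSComplete G) where

  open WhitePaths G
  open Forcing G

  -- If two first forces of p had different targets, the two slides would be
  -- adjacent minimum sets, which makes the targets adjacent and the sources
  -- equal, contradicting the uniqueness clause of the first force.
  forceTarget-unique : IsMinPSDForcingSet G p → PSDForce G p x y → PSDForce G p z w → y ≡ w
  forceTarget-unique {p = p} {x = x} {y = y} {z = z} {w = w}
                     p-isMin fxy@(_ , y∉p , _ , only) fzw@(z∈p , w∉p , zw , _) with y ≟ w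
  ... | yes y≡w = y≡w
  ... | no y≢w = ⊥-elim (y≢w (≡-sym (only w (step y∉p yw (here w∉p)) xw)))
    where
    y∉slide-zw : y ∉ slide p z w
    y∉slide-zw = ∉slide y∉p y≢w
    w∉slide-xy : w ∉ slide p x y
    w∉slide-xy = ∉slide w∉p (y≢w ∘ ≡-sym)
    slides-adjacent : TSAdj G (slide p x y) (slide p z w)
    slides-adjacent = complete _ _ (slide-isMin p-isMin fxy) (slide-isMin p-isMin fzw)
      (λ eq → y∉slide-zw (subst (y ∈_) eq (y∈slide p x y)))
    yw : Adj G y w
    yw = TSAdj⇒Adj slides-adjacent (y∈slide p x y) y∉slide-zw (y∈slide p z w) w∉slide-xy
    z∉slide-xy : z ∉ slide p x y
    z∉slide-xy z∈ = y∉p (subst (_∈ p)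
      (TSAdj⇒leaver-unique slides-adjacent z∈ (x∉slide z∈p w∉p) (y∈slide p x y) y∉slide-zw) z∈p)
    xw : Adj G x w
    xw = subst (λ v → Adj G v w) (z∈p∧z∉slide⇒z≡x z∈p z∉slide-xy) zw

  -- In the slid set the reverse force y → x is a first force, so every white
  -- component there is forced into x; but z cannot reach x.
  forceTarget-isolated : IsMinPSDForcingSet G p → PSDForce G p x y → WhitePath G p z y →
                         ¬ ¬ (z ≡ y)
  forceTarget-isolated {p = p} {x = x} {y = y} {z = z} p-isMin fxy to-y z≢y =
    componentForced (∉slide (WhitePath-start to-y) z≢y) (proj₁ slid-isMin)
      λ (_ , _ , f , to-target) →
      slide-separates fxy (WhitePath-reverse to-y)
        (subst (WhitePath G _ z) (forceTarget-unique slid-isMin f (PSDForce-reverse fxy)) to-target) refl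
    where
    slid-isMin : IsMinPSDForcingSet G (slide p x y)
    slid-isMin = slide-isMin p-isMin fxy

  white-unique : IsMinPSDForcingSet G p → x ∉ p → y ∉ p → x ≡ y
  white-unique {p = p} {x = x} {y = y} p-isMin x∉p y∉p = decidable-stable (x ≟ y) λ x≢y →
    componentForced x∉p (proj₁ p-isMin) λ (_ , _ , fx , to-x′) →
    componentForced y∉p (proj₁ p-isMin) λ (_ , _ , fy , to-y′) →
    forceTarget-isolated p-isMin fx to-x′ λ x≡x′ →
    forceTarget-isolated p-isMin fy to-y′ λ y≡y′ →
    x≢y (trans x≡x′ (trans (forceTarget-unique p-isMin fx fy) (≡-sym y≡y′)))

  TSAdj⇒Adj-white : IsMinPSDForcingSet G p → IsMinPSDForcingSet G q → x ∉ p → y ∉ q →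
                    TSAdj G p q → Adj G y x
  TSAdj⇒Adj-white p-isMin q-isMin x∉p y∉q (_ , _ , _ , v∉q , _ , w∉p , _ , e) =
    subst₂ (Adj G) (white-unique q-isMin v∉q y∉q) (white-unique p-isMin w∉p x∉p) e

module CoSingletons {m} (G : Graph (suc m)) (noIsolated : NoIsolated G) (complete : TSComplete G) where

  open Forcing G
  open UniqueWhite G complete public

  isMin⇒∃∉ : IsMinPSDForcingSet G p → ∃ (_∉ p)
  isMin⇒∃∉ {p = p} (_ , minimal) with nonempty? (∁ p)
  ... | yes (x , x∈∁p) = x , x∈∁p⇒x∉p x∈∁p
  ... | no ∁p-empty = ⊥-elim (<-irrefl refl (begin-strict
    m              ≡⟨ ≡-sym (∣⊤-x∣≡n v) ⟩
    ∣ ⊤ - v ∣      <⟨ x∈p⇒∣p-x∣<∣p∣ {x = v} {p = ⊤} ∈⊤ ⟩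
    ∣ ⊤ {suc m} ∣  ≤⟨ p⊆q⇒∣p∣≤∣q∣ ⊤⊆p ⟩
    ∣ p ∣          ≤⟨ minimal _ (⊤-x-isPSDForcingSet (proj₂ (noIsolated v))) ⟩
    ∣ ⊤ - v ∣      ≡⟨ ∣⊤-x∣≡n v ⟩
    m              ∎))
    where
    open ℕ-≤-Reasoning
    v : Fin (suc m)
    v = zero
    ⊤⊆p : ⊤ ⊆ p
    ⊤⊆p {x} _ = x∉∁p⇒x∈p (λ x∈∁p → ∁p-empty (x , x∈∁p))

  isMin⇒≡⊤-x : IsMinPSDForcingSet G p → x ∉ p → p ≡ ⊤ - x
  isMin⇒≡⊤-x {p = p} {x = x} p-isMin x∉p = ⊆-antisym p⊆⊤-x ⊤-x⊆p
    where
    p⊆⊤-x : p ⊆ ⊤ - x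
    p⊆⊤-x y∈p = x∈p∧x≢y⇒x∈p-y ∈⊤ (λ { refl → x∉p y∈p })
    ⊤-x⊆p : ⊤ - x ⊆ p
    ⊤-x⊆p {y} y∈ with y ∈? p
    ... | yes y∈p = y∈p
    ... | no y∉p = ⊥-elim (x∈p-y⇒x≢y y∈ (white-unique p-isMin y∉p x∉p))

  isPSDForcingSet⇒m≤∣p∣ : IsPSDForcingSet G p → m ≤ ∣ p ∣
  isPSDForcingSet⇒m≤∣p∣ {p = p} = lowerBound-fromMinimal (IsPSDForcingSet G) ∣_∣ m isMin⇒m≤ p
    where
    isMin⇒m≤ : ∀ q → IsPSDForcingSet G q → (∀ r → IsPSDForcingSet G r → ∣ q ∣ ≤ ∣ r ∣) →
               m ≤ ∣ q ∣
    isMin⇒m≤ q forcing minimal with isMin⇒∃∉ (forcing , minimal)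
    ... | x , x∉q = ≤-reflexive (trans (≡-sym (∣⊤-x∣≡n x))
                                       (cong ∣_∣ (≡-sym (isMin⇒≡⊤-x (forcing , minimal) x∉q))))

  ⊤-x-isMin : ∀ x → IsMinPSDForcingSet G (⊤ - x)
  ⊤-x-isMin x = ⊤-x-isPSDForcingSet (proj₂ (noIsolated x)) ,
    λ q q-forcing → subst (_≤ ∣ q ∣) (≡-sym (∣⊤-x∣≡n x)) (isPSDForcingSet⇒m≤∣p∣ q-forcing)

mainTheorem10 : ∀ {m} (G : Graph (suc m)) (n : ℕ) →
    NoIsolated G → TSIsoComplete G n → IsoComplete G n
mainTheorem10 {m} G n noIsolated iso@(f , f-isMin , f-injective , f-onto , f-adj) =
  mk↔ₛ′ white index white∘index index∘white , adj⇔≢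
  where
  open WhitePaths G
  open CoSingletons G noIsolated (TSIsoComplete⇒TSComplete iso)
  white : Fin n → Fin (suc m)
  white i = proj₁ (isMin⇒∃∉ (f-isMin i))
  white∉ : ∀ i → white i ∉ f i
  white∉ i = proj₂ (isMin⇒∃∉ (f-isMin i))
  index : Fin (suc m) → Fin n
  index x = proj₁ (f-onto (⊤ - x) (⊤-x-isMin x))
  f∘index : ∀ x → f (index x) ≡ ⊤ - x
  f∘index x = proj₂ (f-onto (⊤ - x) (⊤-x-isMin x))
  white∘index : ∀ x → white (index x) ≡ x
  white∘index x = x∉⊤-y⇒x≡y (subst (white (index x) ∉_) (f∘index x) (white∉ (index x)))
  index∘white : ∀ i → index (white i) ≡ i
  index∘white i =
    f-injective _ _ (trans (f∘index (white i)) (≡-sym (isMin⇒≡⊤-x (f-isMin i) (white∉ i))))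
  adj⇔≢ : ∀ i j → Adj G (white i) (white j) ⇔ (i ≢ j)
  adj⇔≢ i j = mk⇔ (λ e → Adj⇒≢ e ∘ cong white)
    (λ i≢j → TSAdj⇒Adj-white (f-isMin j) (f-isMin i) (white∉ j) (white∉ i)
                             (Equivalence.from (f-adj j i) (i≢j ∘ ≡-sym)))
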